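{- Let $D$ be a comparability digraph. Then the knotting graph $\tilde K_D$ is bipartite, $D$ contains no odd closed knotting walk, and $I\neq I^{ -1}$ for every implication class $I$ of $D$.
   Context: A digraph $D=(V,A)$ is finite, without loops or multiple arcs; write $uv\in A$ for an arc. A comparability digraph is a digraph admitting a linear ordering $\prec$ of $V$ such that for all $x\prec y\prec z$: $xy,yz\in A$ implies $xz\in A$, and $zy,yx\in A$ implies $zx\in A$. Let $Z_D=\{(x,y): xy\in A\text{ or }yx\in A\}$. For $(x,y),(x',y')\in Z_D$ write $(x,y)\Gamma(x',y')$ if one of the following holds: (i) $x=x'$ and $y=y'$; (ii) $x=x'$, $y\ne y'$, and either ($yx,x'y'\in A$ and $yy'\notin A$) or ($y'x',xy\in A$ and $y'y\notin A$); (iii) $y=y'$, $x\ne x'$, and either ($xy,y'x'\in A$ and $xx'\notin A$) or ($x'y',yx\in A$ and $x'x\notin A$). The equivalence classes of the transitive closure $\Gamma^*$ of $\Gamma$ on $Z_D$ are the implication classes of $D$. For $I\subseteq Z_D$, $I^{ -1}=\{(y,x):(x,y)\in I\}$. For a vertex $x$, pairs $(x,y),(x,z)\in Z_D$ are knotted if there are $y=y_0,\dots,y_k=z$ with $(x,y_{i-1})\Gamma(x,y_i)$ for all $i$; this partitions $N(x)=\{y:(x,y)\in Z_D\}$ into classes $x^1,\dots,x^{\ell_x}$ (partial copies of $x$). The knotting graph $\tilde K_D$ has as vertices all partial copies of all vertices, and an edge $x^\alpha y^\beta$ whenever $x,y$ are adjacent, $y\in x^\alpha$ and $x\in y^\beta$.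 A closed knotting walk of length $p$ is a cyclic sequence of vertices $x_0,\dots,x_{p-1}$ (indices mod $p$) with $(x_i,x_{i+1})\in Z_D$ and such that $(x_i,x_{i-1})$ and $(x_i,x_{i+1})$ are knotted for every $i$; it is odd if $p$ is odd. -}

module Defs where

open import Data.Nat using (ℕ; suc; _+_; _*_; _<_)
open import Data.Fin using (Fin)
open import Data.Bool using (Bool; true; false)
open import Data.Product using (Σ; ∃; ∃-syntax; _×_; _,_)
open import Data.Sum using (_⊎_)
open import Relation.Nullary using (¬_)
open import Relation.Binary.PropositionalEquality using (_≡_; _≢_)
open import Relation.Binary.Construct.Closure.ReflexiveTransitive using (Star)
open import Function.Definitions using (Injective)

record Digraph : Set where
  field
    n        : ℕ
    arc      : Fin n → Fin n → Bool
    loopless : ∀ x → arc x x ≡ false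

Odd : ℕ → Set
Odd p = ∃[ k ] p ≡ suc (2 * k)

module _ (D : Digraph) where
  open Digraph D

  V : Set
  V = Fin n

  Arc : V → V → Set
  Arc u v = arc u v ≡ true

  NoArc : V → V → Set
  NoArc u v = arc u v ≡ false

  -- comparability digraph: a linear ordering ≺ of V, given by an injective
  -- position map (x ≺ y iff pos x < pos y), with the two transitivity rules
  IsComparabilityOrder : (V → ℕ) → Set
  IsComparabilityOrder pos =
    Injective _≡_ _≡_ pos ×
    (∀ x y z → pos x < pos y → pos y < pos z →
       (Arc x y → Arc y z → Arc x z) × (Arc z y → Arc y x → Arc z x))

  IsComparabilityDigraph : Set
  IsComparabilityDigraph = ∃[ pos ] IsComparabilityOrder pos

  Z : V → V → Set
  Z x y = Arc x y ⊎ Arc y x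

  Pair : Set
  Pair = V × V

  ZP : Pair → Set
  ZP (x , y) = Z x y

  inv : Pair → Pair
  inv (x , y) = (y , x)

  data Γ : Pair → Pair → Set where
    Γ-refl : ∀ {x y} → Z x y → Γ (x , y) (x , y)
    Γ-ii   : ∀ {x y y'} → Z x y → Z x y' → y ≢ y' →
             ((Arc y x × Arc x y' × NoArc y y') ⊎ (Arc y' x × Arc x y × NoArc y' y)) →
             Γ (x , y) (x , y')
    Γ-iii  : ∀ {x x' y} → Z x y → Z x' y → x ≢ x' →
             ((Arc x y × Arc y x' × NoArc x x') ⊎ (Arc x' y × Arc y x × NoArc x' x)) →
             Γ (x , y) (x' , y)

  -- transitive closure Γ* (on Z_D, where Γ is reflexive, Star Γ coincides
  -- with the transitive closure)
  Γ* : Pair → Pair → Set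
  Γ* = Star Γ

  InClass : Pair → Pair → Set
  InClass z p = ZP p × Γ* z p

  InClassInv : Pair → Pair → Set
  InClassInv z p = InClass z (inv p)

  ClassDiffersFromInverse : Pair → Set
  ClassDiffersFromInverse z =
    ¬ (∀ p → (InClass z p → InClassInv z p) × (InClassInv z p → InClass z p))

  Knotted : V → V → V → Set
  Knotted x y z = Z x y × Z x z × Star (λ a b → Γ (x , a) (x , b)) y z

  -- vertices of the knotting graph: a partial copy x^α represented by
  -- (x , y) with y ∈ x^α; two representatives denote the same partial copy
  -- iff they are knotted
  KVertex : Set
  KVertex = Σ V λ x → Σ V λ y → Z x y

  SameCopy : KVertex → KVertex → Set
  SameCopy (x , y , _) (x' , y' , _) = Σ (x ≡ x') λ { _≡_.refl → Knotted x y y' }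

  -- edge x^α y^β: x,y adjacent, y ∈ x^α, x ∈ y^β
  KEdge : KVertex → KVertex → Set
  KEdge (x , a , _) (y , b , _) = Z x y × Knotted x a y × Knotted y b x

  KnottingGraphBipartite : Set
  KnottingGraphBipartite =
    Σ (KVertex → Bool) λ c →
      (∀ u v → SameCopy u v → c u ≡ c v) ×
      (∀ u v → KEdge u v → c u ≢ c v)

  -- closed knotting walk of length p, given as a p-periodic sequence
  IsClosedKnottingWalk : ℕ → (ℕ → V) → Set
  IsClosedKnottingWalk p w =
    (∀ i → w (i + p) ≡ w i) ×
    (∀ i → Z (w i) (w (suc i))) ×
    (∀ i → Knotted (w (suc i)) (w i) (w (suc (suc i))))

  NoOddClosedKnottingWalk : Set
  NoOddClosedKnottingWalk = ∀ p w → Odd p → ¬ IsClosedKnottingWalk p w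

module Submission where

open import Defs
open import Data.Bool using (Bool; not)
open import Data.Bool.Properties using (not-¬; not-involutive)
open import Data.Empty using (⊥-elim)
open import Data.Nat using (ℕ; zero; suc; _*_; _<_; _<?_)
open import Data.Nat.Properties using (<-cmp; <-asym; *-suc)
open import Data.Product using (_×_; _,_; proj₁; proj₂)
open import Data.Sum using (_⊎_; inj₁; inj₂)
open import Function using (_∘′_)
open import Relation.Binary using (Rel; tri<; tri≈; tri>)
open import Relation.Binary.PropositionalEquality
  using (_≡_; _≢_; refl; sym; trans; cong; cong₂; module ≡-Reasoning)
open import Relation.Binary.Construct.Closure.ReflexiveTransitive using (Star; ε; gfold)
open import Relation.Nullary using (¬_; does)
open import Relation.Nullary.Decidable using (dec-true; dec-false)

-- Every pair (x , y) of Z_D is oriented forward or backward by the linear order.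
-- Γ preserves the orientation while inversion reverses it, so the orientation
-- 2-colours the knotting graph, alternates along a knotting walk (which must
-- therefore have even length), and separates an implication class from its inverse.

Star-invariant : ∀ {a b r} {A : Set a} {B : Set b} {R : Rel A r} (f : A → B) →
                 (∀ {x y} → R x y → f x ≡ f y) → ∀ {x y} → Star R x y → f x ≡ f y
Star-invariant f invariant = gfold f _≡_ (λ r eq → trans (invariant r) eq) refl

alternating-odd : (s : ℕ → Bool) → (∀ i → s (suc i) ≡ not (s i)) →
                  ∀ {p} → Odd p → s p ≡ not (s 0)
alternating-odd s alt (zero , refl) = alt 0
alternating-odd s alt (suc k , refl) = begin
  s (suc (2 * suc k))         ≡⟨ cong (s ∘′ suc) (*-suc 2 k) ⟩
  s (suc (suc (suc (2 * k)))) ≡⟨ alt _ ⟩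
  not (s (suc (suc (2 * k)))) ≡⟨ cong not (alt _) ⟩
  not (not (s (suc (2 * k)))) ≡⟨ not-involutive _ ⟩
  s (suc (2 * k))             ≡⟨ alternating-odd s alt (k , refl) ⟩
  not (s 0)                   ∎
  where open ≡-Reasoning

Between : ℕ → ℕ → ℕ → Set
Between a m b = (a < m × m < b) ⊎ (b < m × m < a)

<?-flip : ∀ {a b} → a ≢ b → does (b <? a) ≡ not (does (a <? b))
<?-flip {a} {b} a≢b with <-cmp a b
... | tri< a<b _ _ = trans (dec-false (b <? a) (<-asym a<b)) (cong not (sym (dec-true (a <? b) a<b)))
... | tri≈ _ a≡b _ = ⊥-elim (a≢b a≡b)
... | tri> _ _ b<a = trans (dec-true (b <? a) b<a) (cong not (sym (dec-false (a <? b) (<-asym b<a))))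

unseparated-<? : ∀ {a m b} → a ≢ m → b ≢ m → ¬ Between a m b → does (a <? m) ≡ does (b <? m)
unseparated-<? {a} {m} {b} a≢m b≢m apart with <-cmp a m | <-cmp b m
... | tri≈ _ a≡m _ | _            = ⊥-elim (a≢m a≡m)
... | _            | tri≈ _ b≡m _ = ⊥-elim (b≢m b≡m)
... | tri< a<m _ _ | tri< b<m _ _ = trans (dec-true (a <? m) a<m) (sym (dec-true (b <? m) b<m))
... | tri< a<m _ _ | tri> _ _ m<b = ⊥-elim (apart (inj₁ (a<m , m<b)))
... | tri> _ _ m<a | tri< b<m _ _ = ⊥-elim (apart (inj₂ (b<m , m<a)))
... | tri> _ _ m<a | tri> _ _ m<b = trans (dec-false (a <? m) (<-asym m<a)) (sym (dec-false (b <? m) (<-asym m<b)))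

unseparated->? : ∀ {a m b} → a ≢ m → b ≢ m → ¬ Between a m b → does (m <? a) ≡ does (m <? b)
unseparated->? {a} {m} {b} a≢m b≢m apart = begin
  does (m <? a)       ≡⟨ <?-flip a≢m ⟩
  not (does (a <? m)) ≡⟨ cong not (unseparated-<? a≢m b≢m apart) ⟩
  not (does (b <? m)) ≡⟨ sym (<?-flip b≢m) ⟩
  does (m <? b)       ∎
  where open ≡-Reasoning

module ComparabilityOrder (D : Digraph) (pos : V D → ℕ) (order : IsComparabilityOrder D pos) where

  arc⇒pos≢ : ∀ {x y} → Arc D x y → pos x ≢ pos y
  arc⇒pos≢ {x} xy eq with proj₁ order eq
  ... | refl with trans (sym xy) (Digraph.loopless D x)
  ...   | ()

  Z⇒pos≢ : ∀ {x y} → Z D x y → pos x ≢ pos y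
  Z⇒pos≢ (inj₁ xy) = arc⇒pos≢ xy
  Z⇒pos≢ (inj₂ yx) = arc⇒pos≢ yx ∘′ sym

  shortcut : ∀ {u m v} → Arc D u m → Arc D m v → Between (pos u) (pos m) (pos v) → Arc D u v
  shortcut {u} {m} {v} um mv (inj₁ (u<m , m<v)) = proj₁ (proj₂ order u m v u<m m<v) um mv
  shortcut {u} {m} {v} um mv (inj₂ (v<m , m<u)) = proj₂ (proj₂ order v m u v<m m<u) um mv

  detour-unseparated : ∀ {u m v} → Arc D u m → Arc D m v → NoArc D u v →
                       ¬ Between (pos u) (pos m) (pos v)
  detour-unseparated um mv no-uv between with trans (sym (shortcut um mv between)) no-uv
  ... | ()

  forward : Pair D → Bool
  forward (x , y) = does (pos x <? pos y)

  forward-inv : ∀ {x y} → Z D x y → forward (y , x) ≡ not (forward (x , y))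
  forward-inv xy = <?-flip (Z⇒pos≢ xy)

  -- A Γ-step is a directed 2-path u → m → v without the arc uv; its middle
  -- vertex m is the common vertex of the two pairs and, by transitivity of
  -- the order, cannot lie between u and v.
  Γ-forward : ∀ {p q} → Γ D p q → forward p ≡ forward q
  Γ-forward (Γ-refl _) = refl
  Γ-forward (Γ-ii _ _ _ (inj₁ (yx , xy' , no))) =
    unseparated->? (arc⇒pos≢ yx) (arc⇒pos≢ xy' ∘′ sym) (detour-unseparated yx xy' no)
  Γ-forward (Γ-ii _ _ _ (inj₂ (y'x , xy , no))) =
    sym (unseparated->? (arc⇒pos≢ y'x) (arc⇒pos≢ xy ∘′ sym) (detour-unseparated y'x xy no))
  Γ-forward (Γ-iii _ _ _ (inj₁ (xy , yx' , no))) =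
    unseparated-<? (arc⇒pos≢ xy) (arc⇒pos≢ yx' ∘′ sym) (detour-unseparated xy yx' no)
  Γ-forward (Γ-iii _ _ _ (inj₂ (x'y , yx , no))) =
    sym (unseparated-<? (arc⇒pos≢ x'y) (arc⇒pos≢ yx ∘′ sym) (detour-unseparated x'y yx no))

  Γ*-forward : ∀ {p q} → Γ* D p q → forward p ≡ forward q
  Γ*-forward = Star-invariant forward Γ-forward

  knotted-forward : ∀ {x y z} → Knotted D x y z → forward (x , y) ≡ forward (x , z)
  knotted-forward {x} (_ , _ , knot) = Star-invariant (λ y → forward (x , y)) Γ-forward knot

  knotting-graph-bipartite : KnottingGraphBipartite D
  knotting-graph-bipartite = colour , same-copy , edge
    where
    colour : KVertex D → Bool
    colour (x , y , _) = forward (x , y)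

    same-copy : ∀ u v → SameCopy D u v → colour u ≡ colour v
    same-copy _ _ (refl , knot) = knotted-forward knot

    edge : ∀ u v → KEdge D u v → colour u ≢ colour v
    edge (x , a , _) (y , b , _) (xy , x-knot , y-knot) same = not-¬ refl (begin
      forward (x , y)       ≡⟨ sym (knotted-forward x-knot) ⟩
      forward (x , a)       ≡⟨ same ⟩
      forward (y , b)       ≡⟨ knotted-forward y-knot ⟩
      forward (y , x)       ≡⟨ forward-inv xy ⟩
      not (forward (x , y)) ∎)
      where open ≡-Reasoning

  no-odd-closed-knotting-walk : NoOddClosedKnottingWalk D
  no-odd-closed-knotting-walk p w odd (periodic , adjacent , knotted) =
    not-¬ refl (trans (sym closes) (alternating-odd orientation alternates odd))
    where
    orientation : ℕ → Bool
    orientation i = forward (w i , w (suc i))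

    alternates : ∀ i → orientation (suc i) ≡ not (orientation i)
    alternates i = trans (sym (knotted-forward (knotted i))) (forward-inv (adjacent i))

    closes : orientation p ≡ orientation 0
    closes = cong₂ (λ x y → forward (x , y)) (periodic 0) (periodic 1)

  class-differs-from-inverse : ∀ z → ZP D z → ClassDiffersFromInverse D z
  class-differs-from-inverse (x , y) xy same-class =
    not-¬ refl (trans (Γ*-forward xy→yx) (forward-inv xy))
    where
    xy→yx : Γ* D (x , y) (y , x)
    xy→yx = proj₂ (proj₁ (same-class (x , y)) (xy , ε))

mainTheorem8 : (D : Digraph) → IsComparabilityDigraph D →
    KnottingGraphBipartite D × NoOddClosedKnottingWalk D ×
    (∀ z → ZP D z → ClassDiffersFromInverse D z)
mainTheorem8 D (pos , order) =
  knotting-graph-bipartite , no-odd-closed-knotting-walk , class-differs-from-inverse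
  where open ComparabilityOrder D pos order
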